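{- Let $\ell, m, u, v, \alpha$ be positive integers with $u \leq m$, and let $K$ be a set of integers, each at least $2$, with $\ell \in K$. Suppose there exist a TD$(\ell+1,m)$, a TD$(\ell,u)$ containing $\alpha$ pairwise disjoint blocks, a $K$-GDD of type $u^{\ell} v^1$, and an $(mu+1,K)$-PBD. Then for every integer $t$ with $0 \leq t \leq m - \lceil u/\alpha \rceil$ there exists a $K$-GDD of type $\ell^{mu}(tv+1)^1$.
   Context: For a set $K$ of positive integers (each at least $2$), a $K$-GDD (group-divisible design) is a triple $(X,\mathcal{G},\mathcal{A})$ where $X$ is a finite set of points, $\mathcal{G}$ is a partition of $X$ into groups, and $\mathcal{A}$ is a collection of subsets (blocks) of $X$ such that every block meets every group in at most one point, every pair of points from different groups lies in exactly one block, and every block has size in $K$. If $K=\{k\}$ we write $k$-GDD. The type of the GDD is the multiset of group sizes, written exponentially: type $t_1^{u_1} t_2^{u_2}\cdots$ means $u_i$ groups of size $t_i$. A TD$(k,n)$ (transversal design) is a $k$-GDD of type $n^k$. A $(w,K)$-PBD (pairwise balanced design) is a pair $(X,\mathcal{A})$ with $|X|=w$ and $\mathcal{A}$ a collection of subsets (blocks) of $X$ such that every pair of distinct points lies in exactly one block and every block has size in $K$. -}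

module Defs where

open import Data.Nat using (ℕ; zero; suc; _+_; _*_; _∸_; _≤_; NonZero)
open import Data.Nat.DivMod using (_/_)
open import Data.Fin using (Fin; _≟_)
open import Data.Fin.Subset using (Subset; _∈_; ∣_∣)
open import Data.List using (List; length; lookup; filter; replicate; _++_; [_])
open import Data.Nat.ListAction using (sum)
open import Data.List.Base using (allFin)
open import Data.Product using (Σ; _×_; ∃)
open import Relation.Binary.PropositionalEquality using (_≡_; _≢_)
open import Relation.Nullary using (¬_)

⌈_/_⌉ : ℕ → (α : ℕ) → .{{NonZero α}} → ℕ
⌈ u / α ⌉ = (u + α ∸ 1) / α

-- Points are Fin (sum ty); blocks are
-- subsets of the point set (a list, so repeated blocks are allowed, but
-- the "exactly one block" condition is on block indices).
record GDD (K : ℕ → Set) (ty : List ℕ) : Set where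
  field
    grp    : Fin (sum ty) → Fin (length ty)
    grp-size : ∀ (j : Fin (length ty)) →
               length (filter (λ x → grp x ≟ j) (allFin (sum ty))) ≡ lookup ty j
    blocks : List (Subset (sum ty))
    block-size : ∀ (i : Fin (length blocks)) → K ∣ lookup blocks i ∣
    block-transversal : ∀ (i : Fin (length blocks)) (x y : Fin (sum ty)) →
                        x ∈ lookup blocks i → y ∈ lookup blocks i → grp x ≡ grp y → x ≡ y
    pair-cover : ∀ (x y : Fin (sum ty)) → grp x ≢ grp y →
                 Σ (Fin (length blocks)) λ i →
                   (x ∈ lookup blocks i × y ∈ lookup blocks i) ×
                   (∀ (j : Fin (length blocks)) → x ∈ lookup blocks j → y ∈ lookup blocks j → j ≡ i)

Single : ℕ → ℕ → Set
Single k n = n ≡ k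

TD : ℕ → ℕ → Set
TD k n = GDD (Single k) (replicate k n)

TDWithDisjointBlocks : ℕ → ℕ → ℕ → Set
TDWithDisjointBlocks k n α =
  Σ (TD k n) λ D →
    let open GDD D in
    Σ (Fin α → Fin (length blocks)) λ f →
      (∀ a b → f a ≡ f b → a ≡ b) ×
      (∀ a b → a ≢ b → ∀ x → x ∈ lookup blocks (f a) → ¬ (x ∈ lookup blocks (f b)))

record PBD (w : ℕ) (K : ℕ → Set) : Set where
  field
    blocks : List (Subset w)
    block-size : ∀ (i : Fin (length blocks)) → K ∣ lookup blocks i ∣
    pair-cover : ∀ (x y : Fin w) → x ≢ y →
                 Σ (Fin (length blocks)) λ i →
                   (x ∈ lookup blocks i × y ∈ lookup blocks i) ×
                   (∀ (j : Fin (length blocks)) → x ∈ lookup blocks j → y ∈ lookup blocks j → j ≡ i)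

-- Wilson's fundamental construction. Read the TD(ℓ+1, m) as an orthogonal array whose column zero is
-- a group that is not inflated, and give every point of the other ℓ columns weight u. The first t points of
-- column zero receive v new points each; together with one more point ∞ these form the group of size tv + 1.
-- Every row through one of these t points is filled with the K-GDD of type uˡ v¹. Every other row is
-- filled with the TD(ℓ, u) minus some of its α disjoint blocks, which leaves holes; hole f ∈ Fin u is cut
-- from row z = t + ⌊f/α⌋ using disjoint block f mod α, and t + ⌈u/α⌉ ≤ m is exactly what makes room.
-- Each inflated column together with ∞ is filled with the (mu+1)-PBD. No block then contains two points
-- of a hole, so the holes (hole f on each of the m rows through its point z) are the mu groups of size ℓ.

module Submission where

open import Defs
open import Data.Nat using (ℕ; _+_; _*_; _≤_; NonZero)
open import Data.List using (replicate; _++_; [_])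

open import Data.Bool using (Bool; true; false; T; T?; not; _∧_)
open import Data.Bool.Properties using (T-irrelevant; T-∧; T-≡)
open import Data.Empty using (⊥; ⊥-elim)
open import Data.Fin as Fin using (Fin; zero; suc; cast; toℕ; fromℕ<; inject≤)
open import Data.Fin.Permutation using (Permutation′; cast-id; transpose; _⟨$⟩ʳ_; _⟨$⟩ˡ_)
open import Data.Fin.Properties
  using (_≟_; suc-injective; +↔⊎; *↔×; 1↔⊤; cantor-schröder-bernstein; injective⇒≤; any?;
         punchOut-injective; cast-involutive; toℕ-injective; toℕ-fromℕ<; toℕ-inject≤; toℕ<n)
open import Data.Fin.Subset using (Subset; ∣_∣) renaming (_∈_ to _∈ˢ_)
open import Data.List as List using (List; []; _∷_; length; lookup; filter; allFin)
open import Data.List.Membership.Propositional using (_∈_)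
open import Data.List.Membership.Propositional.Properties using (∈-allFin)
open import Data.List.Properties using (length-++; length-replicate; length-tabulate; lookup-replicate)
open import Data.List.Relation.Unary.Any using (here; there)
open import Data.Nat using (zero; suc; _∸_; _<_; _<ᵇ_; _/_; _%_; >-nonZero⁻¹)
open import Data.Nat.DivMod using (m≡m%n+[m/n]*n; m/n≡1+[m∸n]/n; /-monoˡ-≤; m%n<n)
open import Data.Nat.ListAction using (sum)
open import Data.Nat.Properties
  using (1+n≰n; <-≤-trans; +-monoʳ-<; +-cancelˡ-≡; m≤m+n; <⇒≱; m+n∸n≡m; m≤n+m; m+[n∸m]≡n;
         +-assoc; +-comm; +-monoˡ-≤; ≤-trans; ≤-reflexive; +-∸-assoc; <ᵇ⇒<; <⇒<ᵇ; module ≤-Reasoning)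
open import Data.Product using (Σ; ∃-syntax; ∃!; _×_; _,_; proj₁; proj₂)
open import Data.Product.Function.Dependent.Propositional using (Σ-↔)
open import Data.Product.Function.NonDependent.Propositional using (_×-↔_)
open import Data.Product.Properties using (×-≡,≡←≡)
open import Data.Sum as Sum using (_⊎_; inj₁; inj₂; [_,_]′)
open import Data.Sum.Function.Propositional using (_⊎-↔_)
open import Data.Sum.Properties using (inj₁-injective)
open import Data.Unit using (⊤; tt)
import Data.Vec as Vec
open import Data.Vec.Properties using ([]=⇒lookup; lookup⇒[]=; lookup∘tabulate)
open import Function using (_∘_; id; Equivalence)
open import Function.Bundles using (_↔_; Inverse; mk↔ₛ′)
open import Function.Construct.Composition using (_↔-∘_)
open import Function.Construct.Identity using (↔-id)
open import Function.Construct.Symmetry using (↔-sym)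
open import Function.Definitions using (Injective)
open import Relation.Binary.PropositionalEquality hiding ([_])
open import Relation.Nullary using (¬_; Dec; yes; no; does)
open import Relation.Nullary.Decidable using (dec-true; dec-false; _×-dec_)
open import Relation.Unary using (Decidable)

open Inverse using (to; from; strictlyInverseˡ; strictlyInverseʳ)

-- Finite types

private variable
  A B : Set
  m n : ℕ

to-injective : (e : A ↔ B) {x y : A} → to e x ≡ to e y → x ≡ y
to-injective e {x} {y} p = trans (sym (strictlyInverseʳ e x)) (trans (cong (from e) p) (strictlyInverseʳ e y))

Fin↔⇒≡ : Fin m ↔ Fin n → m ≡ n
Fin↔⇒≡ e = cantor-schröder-bernstein (to-injective e) (to-injective (↔-sym e))

Sat : (A → Bool) → Set
Sat {A} P = Σ A (T ∘ P)

Sat-≡ : {P : A → Bool} {a a' : A} {p : T (P a)} {p' : T (P a')} → a ≡ a' → _≡_ {A = Sat P} (a , p) (a' , p')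
Sat-≡ {p = p} {p'} refl = cong (_ ,_) (T-irrelevant p p')

Sat-≗ : {P Q : A → Bool} → (∀ a → P a ≡ Q a) → Sat P ↔ Sat Q
Sat-≗ P≗Q = mk↔ₛ′ (λ (a , p) → a , subst T (P≗Q a) p) (λ (a , q) → a , subst T (sym (P≗Q a)) q)
  (λ _ → Sat-≡ refl) (λ _ → Sat-≡ refl)

Sat-∘↔ : (e : A ↔ B) (P : B → Bool) → Sat (P ∘ to e) ↔ Sat P
Sat-∘↔ e P = mk↔ₛ′ (λ (a , p) → to e a , p)
  (λ (b , q) → from e b , subst (T ∘ P) (sym (strictlyInverseˡ e b)) q)
  (λ (b , q) → Sat-≡ (strictlyInverseˡ e b)) (λ (a , p) → Sat-≡ (strictlyInverseʳ e a))

Σ-Fin-suc↔ : (F : Fin (suc n) → Set) → Σ (Fin (suc n)) F ↔ (F zero ⊎ Σ (Fin n) (F ∘ suc))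
Σ-Fin-suc↔ F = mk↔ₛ′ (λ { (zero , x) → inj₁ x ; (suc i , x) → inj₂ (i , x) })
                     (λ { (inj₁ x) → zero , x ; (inj₂ (i , x)) → suc i , x })
                     (λ { (inj₁ x) → refl ; (inj₂ (i , x)) → refl })
                     (λ { (zero , x) → refl ; (suc i , x) → refl })

Sat-lookup↔ : (s : Subset n) → Sat (Vec.lookup s) ↔ Fin ∣ s ∣
Sat-lookup↔ Vec.[] = mk↔ₛ′ (λ { (() , _) }) (λ ()) (λ ()) (λ { (() , _) })
Sat-lookup↔ (true Vec.∷ s) = ↔-sym +↔⊎ ↔-∘ ((↔-sym 1↔⊤ ⊎-↔ Sat-lookup↔ s) ↔-∘ Σ-Fin-suc↔ _)
Sat-lookup↔ (false Vec.∷ s) = Sat-lookup↔ s ↔-∘ drop-zero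
  where
    drop-zero : Sat (Vec.lookup (false Vec.∷ s)) ↔ Sat (Vec.lookup s)
    drop-zero = mk↔ₛ′ (λ { (suc i , p) → i , p }) (λ (i , p) → suc i , p)
                      (λ _ → refl) (λ { (suc i , p) → refl })

Sat↔Fin : (P : Fin n → Bool) → Sat P ↔ Fin ∣ Vec.tabulate P ∣
Sat↔Fin P = Sat-lookup↔ (Vec.tabulate P) ↔-∘ Sat-≗ (λ x → sym (lookup∘tabulate P x))

length-filter-tabulate : {Q : A → Set} (Q? : Decidable Q) (f : Fin n → A) →
  length (filter Q? (List.tabulate f)) ≡ ∣ Vec.tabulate (does ∘ Q? ∘ f) ∣
length-filter-tabulate {n = zero} Q? f = refl
length-filter-tabulate {n = suc n} Q? f with does (Q? (f zero))
... | true = cong suc (length-filter-tabulate Q? (f ∘ suc))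
... | false = length-filter-tabulate Q? (f ∘ suc)

T-does⇒ : {P : Set} (P? : Dec P) → T (does P?) → P
T-does⇒ (yes p) _ = p

⇒T-does : {P : Set} (P? : Dec P) → P → T (does P?)
⇒T-does (yes _) _ = tt
⇒T-does (no ¬p) p = ¬p p

fibre↔ : (F : Fin n → Set) (j : Fin n) → Sat {Σ (Fin n) F} (λ s → does (proj₁ s ≟ j)) ↔ F j
fibre↔ F j = mk↔ₛ′ (λ ((i , x) , p) → subst F (T-does⇒ (i ≟ j) p) x)
  (λ y → (j , y) , ⇒T-does (j ≟ j) refl)
  (λ y → subst-refl (T-does⇒ (j ≟ j) (⇒T-does (j ≟ j) refl)) y)
  (λ ((i , x) , p) → Sat-≡ (unsubst (T-does⇒ (i ≟ j) p) x))
  where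
    subst-refl : (e : j ≡ j) (y : F j) → subst F e y ≡ y
    subst-refl refl y = refl
    unsubst : ∀ {i} (e : i ≡ j) x → _≡_ {A = Σ (Fin _) F} (j , subst F e x) (i , x)
    unsubst refl x = refl

sum↔Σ : (ty : List ℕ) → Fin (sum ty) ↔ Σ (Fin (length ty)) (Fin ∘ lookup ty)
sum↔Σ [] = mk↔ₛ′ (λ ()) (λ { (() , _) }) (λ { (() , _) }) (λ ())
sum↔Σ (a ∷ ty) = ↔-sym (Σ-Fin-suc↔ _) ↔-∘ ((↔-id _ ⊎-↔ sum↔Σ ty) ↔-∘ +↔⊎)

Σ-Fin↔ : (c : Fin n → ℕ) → Σ (Fin n) (Fin ∘ c) ↔ Fin (sum (List.tabulate c))
Σ-Fin↔ {zero} c = mk↔ₛ′ (λ { (() , _) }) (λ ()) (λ ()) (λ { (() , _) })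
Σ-Fin↔ {suc n} c = ↔-sym +↔⊎ ↔-∘ ((↔-id _ ⊎-↔ Σ-Fin↔ (c ∘ suc)) ↔-∘ Σ-Fin-suc↔ _)

fibres⇒↔ : (g : A → Fin n) (F : Fin n → Set) →
  (∀ j → Sat (λ x → does (g x ≟ j)) ↔ F j) → A ↔ Σ (Fin n) F
fibres⇒↔ {A = A} g F φ = mk↔ₛ′ into (λ (j , y) → proj₁ (from (φ j) y)) into∘from
  (λ x → cong proj₁ (strictlyInverseʳ (φ (g x)) (x , _)))
  where
    into : A → Σ (Fin _) F
    into x = g x , to (φ (g x)) (x , ⇒T-does (g x ≟ g x) refl)
    into-fibre : ∀ j (y : F j) x → g x ≡ j → proj₁ (from (φ j) y) ≡ x → into x ≡ (j , y)
    into-fibre j y x refl e =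
      cong (g x ,_) (trans (cong (to (φ (g x))) (Sat-≡ (sym e))) (strictlyInverseˡ (φ (g x)) y))
    into∘from : ∀ s → into (proj₁ (from (φ (proj₁ s)) (proj₂ s))) ≡ s
    into∘from (j , y) = into-fibre j y _ (T-does⇒ (g _ ≟ j) (proj₂ (from (φ j) y))) refl

∈ˢ⇒T : {x : Fin n} {s : Subset n} → x ∈ˢ s → T (Vec.lookup s x)
∈ˢ⇒T x∈s = Equivalence.from T-≡ ([]=⇒lookup x∈s)

T⇒∈ˢ : {x : Fin n} {s : Subset n} → T (Vec.lookup s x) → x ∈ˢ s
T⇒∈ˢ {x = x} {s} t = lookup⇒[]= x s (Equivalence.to T-≡ t)

lookup-tabulate′ : (f : Fin n → A) (i : Fin (length (List.tabulate f))) →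
  lookup (List.tabulate f) i ≡ f (cast (length-tabulate f) i)
lookup-tabulate′ {n = suc n} f zero = refl
lookup-tabulate′ {n = suc n} f (suc i) = lookup-tabulate′ (f ∘ suc) i

injective⇒surjective : (h : Fin n → Fin n) → Injective _≡_ _≡_ h → ∀ y → ∃[ x ] h x ≡ y
injective⇒surjective {suc n} h h-inj y with any? (λ x → h x ≟ y)
... | yes hit = hit
... | no miss = ⊥-elim (1+n≰n (injective⇒≤ punched-injective))
  where
    y≢h : ∀ x → y ≢ h x
    y≢h x y≡hx = miss (x , sym y≡hx)
    punched-injective : Injective _≡_ _≡_ (λ x → Fin.punchOut (y≢h x))
    punched-injective eq = h-inj (punchOut-injective (y≢h _) (y≢h _) eq)

transpose-source : (i j : Fin n) → transpose i j ⟨$⟩ʳ i ≡ j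
transpose-source i j rewrite dec-true (i ≟ i) refl = refl

transpose-other : {i j x : Fin n} → x ≢ i → x ≢ j → transpose i j ⟨$⟩ʳ x ≡ x
transpose-other {i = i} {j} {x} x≢i x≢j rewrite dec-false (x ≟ i) x≢i | dec-false (x ≟ j) x≢j = refl

-- Each new point z of P is put in place by composing with the transposition of π z and d z.
extend-injection-on : (P : Fin n → Bool) (d : Fin n → Fin n) →
  (∀ x y → T (P x) → T (P y) → d x ≡ d y → x ≡ y) → (xs : List (Fin n)) →
  Σ (Permutation′ n) λ π → ∀ x → x ∈ xs → T (P x) → π ⟨$⟩ʳ x ≡ d x
extend-injection-on P d d-inj [] = ↔-id _ , λ _ ()
extend-injection-on P d d-inj (z ∷ xs) with extend-injection-on P d d-inj xs | P z in Pz
... | π , π≗d | false =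
  π , λ { x (here refl) Px → ⊥-elim (subst T Pz Px) ; x (there x∈xs) Px → π≗d x x∈xs Px }
... | π , π≗d | true = transpose (π ⟨$⟩ʳ z) (d z) ↔-∘ π , agrees
  where
    agrees : ∀ x → x ∈ z ∷ xs → T (P x) → transpose (π ⟨$⟩ʳ z) (d z) ⟨$⟩ʳ (π ⟨$⟩ʳ x) ≡ d x
    agrees x (here refl) _ = transpose-source (π ⟨$⟩ʳ x) (d x)
    agrees x (there x∈xs) Px with x ≟ z
    ... | yes refl = transpose-source (π ⟨$⟩ʳ x) (d x)
    ... | no x≢z = trans (cong (transpose (π ⟨$⟩ʳ z) (d z) ⟨$⟩ʳ_) (π≗d x x∈xs Px))
                     (transpose-other (λ dx≡πz → x≢z (to-injective π (trans (π≗d x x∈xs Px) dx≡πz)))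
                                      (λ dx≡dz → x≢z (d-inj x z Px (subst T (sym Pz) tt) dx≡dz)))

extend-injection : (P : Fin n → Bool) (d : Fin n → Fin n) →
  (∀ x y → T (P x) → T (P y) → d x ≡ d y → x ≡ y) →
  Σ (Permutation′ n) λ π → ∀ x → T (P x) → π ⟨$⟩ʳ x ≡ d x
extend-injection {n} P d d-inj = let (π , π≗d) = extend-injection-on P d d-inj (allFin n) in
  π , λ x → π≗d x (∈-allFin x)

-- Designs with arbitrary finite types of points and blocks

module _ {K : ℕ → Set} {ty : List ℕ} (G : GDD K ty) where
  open GDD G

  GDD-fibre↔ : ∀ j → Sat (λ x → does (grp x ≟ j)) ↔ Fin (lookup ty j)
  GDD-fibre↔ j =
    cast-id (trans (sym (length-filter-tabulate (λ x → grp x ≟ j) id)) (grp-size j)) ↔-∘ Sat↔Fin _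

  GDD-points↔ : Fin (sum ty) ↔ Σ (Fin (length ty)) (Fin ∘ lookup ty)
  GDD-points↔ = fibres⇒↔ grp (Fin ∘ lookup ty) GDD-fibre↔

Points : ℕ → ℕ → ℕ → Set
Points k a b = (Fin k × Fin a) ⊎ Fin b

groupOf : {k a b : ℕ} → Points k a b → Fin k ⊎ ⊤
groupOf (inj₁ (j , _)) = inj₁ j
groupOf (inj₂ _) = inj₂ tt

type : ℕ → ℕ → ℕ → List ℕ
type k a b = replicate k a ++ [ b ]

size : {k : ℕ} → ℕ → ℕ → Fin k ⊎ ⊤ → ℕ
size a b = [ (λ _ → a) , (λ _ → b) ]′

groups↔ : (k a b : ℕ) → Fin (length (type k a b)) ↔ (Fin k ⊎ ⊤)
groups↔ k a b = (↔-id _ ⊎-↔ 1↔⊤) ↔-∘ (+↔⊎ ↔-∘ cast-id length-type)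
  where
    length-type : length (type k a b) ≡ k + 1
    length-type = trans (length-++ (replicate k a)) (cong (_+ 1) (length-replicate k))

lookup-type : ∀ k a b (g : Fin k ⊎ ⊤) → lookup (type k a b) (from (groups↔ k a b) g) ≡ size a b g
lookup-type zero a b (inj₂ tt) = refl
lookup-type (suc k) a b (inj₁ zero) = refl
lookup-type (suc k) a b (inj₁ (suc j)) = lookup-type k a b (inj₁ j)
lookup-type (suc k) a b (inj₂ tt) = lookup-type k a b (inj₂ tt)

Σ-size↔Points : (k a b : ℕ) → Σ (Fin k ⊎ ⊤) (Fin ∘ size a b) ↔ Points k a b
Σ-size↔Points k a b = mk↔ₛ′ (λ { (inj₁ j , x) → inj₁ (j , x) ; (inj₂ tt , y) → inj₂ y })
  (λ { (inj₁ (j , x)) → inj₁ j , x ; (inj₂ y) → inj₂ tt , y })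
  (λ { (inj₁ _) → refl ; (inj₂ _) → refl })
  (λ { (inj₁ j , x) → refl ; (inj₂ tt , y) → refl })

reindex-type↔ : (k a b : ℕ) →
  Σ (Fin (length (type k a b))) (Fin ∘ lookup (type k a b)) ↔ Σ (Fin k ⊎ ⊤) (Fin ∘ size a b)
reindex-type↔ k a b = Σ-↔ (groups↔ k a b) (λ {i} → cast-id (size-ok i))
  where
    size-ok : ∀ i → lookup (type k a b) i ≡ size a b (to (groups↔ k a b) i)
    size-ok i = trans (cong (lookup (type k a b)) (sym (strictlyInverseʳ (groups↔ k a b) i)))
                      (lookup-type k a b (to (groups↔ k a b) i))

Points↔ : (k a b : ℕ) → Σ (Fin (length (type k a b))) (Fin ∘ lookup (type k a b)) ↔ Points k a b
Points↔ k a b = Σ-size↔Points k a b ↔-∘ reindex-type↔ k a b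

groupOf-Points↔ : ∀ k a b s → groupOf (to (Points↔ k a b) s) ≡ to (groups↔ k a b) (proj₁ s)
groupOf-Points↔ k a b s = groupOf-Σ-size (to (reindex-type↔ k a b) s)
  where
    groupOf-Σ-size : ∀ (s : Σ (Fin k ⊎ ⊤) (Fin ∘ size a b)) →
      groupOf (to (Σ-size↔Points k a b) s) ≡ proj₁ s
    groupOf-Σ-size (inj₁ _ , _) = refl
    groupOf-Σ-size (inj₂ tt , _) = refl

-- Unlike GDD, points and blocks are arbitrary finite types and the groups are given by a map.
record BlockDesign (K : ℕ → Set) {Point Group : Set} (group : Point → Group) : Set₁ where
  field
    Block       : Set
    #blocks     : ℕ
    block↔      : Block ↔ Fin #blocks
    _∋_         : Block → Point → Bool
    block-size  : ∀ B → ∃[ k ] K k × (Sat (B ∋_) ↔ Fin k)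
    transversal : ∀ B x y → T (B ∋ x) → T (B ∋ y) → group x ≡ group y → x ≡ y
    pair-cover  : ∀ x y → group x ≢ group y → ∃! _≡_ (λ B → T (B ∋ x) × T (B ∋ y))

module _ {K : ℕ → Set} where

  BlockDesign-map : {P P' G G' : Set} {group : P → G} {group' : P' → G'} →
    (e : P' ↔ P) (ι : G → G') → (∀ {g h} → ι g ≡ ι h → g ≡ h) →
    (∀ x → group' x ≡ ι (group (to e x))) → BlockDesign K group → BlockDesign K group'
  BlockDesign-map e ι ι-injective compat D = record
    { Block = Block ; #blocks = #blocks ; block↔ = block↔
    ; _∋_ = λ B x → B ∋ to e x
    ; block-size = λ B → let (k , Kk , B↔k) = block-size B in k , Kk , B↔k ↔-∘ Sat-∘↔ e (B ∋_)
    ; transversal = λ B x y px py eq → to-injective e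
        (transversal B _ _ px py (ι-injective (trans (sym (compat x)) (trans eq (compat y)))))
    ; pair-cover = λ x y ne → pair-cover _ _ (λ eq → ne (trans (compat x) (trans (cong ι eq) (sym (compat y)))))
    }
    where open BlockDesign D

  GDD⇒BlockDesign : {ty : List ℕ} (G : GDD K ty) → BlockDesign K (GDD.grp G)
  GDD⇒BlockDesign G = record
    { Block = Fin (length blocks) ; #blocks = length blocks ; block↔ = ↔-id _
    ; _∋_ = λ i → Vec.lookup (lookup blocks i)
    ; block-size = λ i → ∣ lookup blocks i ∣ , block-size i , Sat-lookup↔ (lookup blocks i)
    ; transversal = λ i x y px py → block-transversal i x y (T⇒∈ˢ px) (T⇒∈ˢ py)
    ; pair-cover = λ x y ne → let (i , (px , py) , uniq) = pair-cover x y ne in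
        i , (∈ˢ⇒T px , ∈ˢ⇒T py) , λ (px' , py') → sym (uniq _ (T⇒∈ˢ px') (T⇒∈ˢ py'))
    }
    where open GDD G

  BlockDesign⇒GDD : {ty : List ℕ} → BlockDesign K (proj₁ ∘ to (sum↔Σ ty)) → GDD K ty
  BlockDesign⇒GDD {ty} D = record
    { grp = grp
    ; grp-size = λ j → trans (length-filter-tabulate (λ x → grp x ≟ j) id)
        (Fin↔⇒≡ (fibre↔ _ j ↔-∘ (Sat-∘↔ (sum↔Σ ty) _ ↔-∘ ↔-sym (Sat↔Fin _))))
    ; blocks = blocks
    ; block-size = λ i → let (k , Kk , B↔k) = block-size (to index↔ i) in
        subst K (sym (Fin↔⇒≡ (B↔k ↔-∘ (↔-sym (Sat↔Fin _) ↔-∘ cast-id (cong ∣_∣ (lookup-blocks i))))))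
          Kk
    ; block-transversal = λ i x y px py → transversal (to index↔ i) x y (∈⇒∋ i px) (∈⇒∋ i py)
    ; pair-cover = cover
    }
    where
      open BlockDesign D
      grp : Fin (sum ty) → Fin (length ty)
      grp = proj₁ ∘ to (sum↔Σ ty)
      blocks : List (Subset (sum ty))
      blocks = List.tabulate (λ i → Vec.tabulate (from block↔ i ∋_))
      index↔ : Fin (length blocks) ↔ Block
      index↔ = ↔-sym block↔ ↔-∘ cast-id (length-tabulate (λ i → Vec.tabulate (from block↔ i ∋_)))
      lookup-blocks : ∀ i → lookup blocks i ≡ Vec.tabulate (to index↔ i ∋_)
      lookup-blocks = lookup-tabulate′ (λ i → Vec.tabulate (from block↔ i ∋_))
      ∈⇒∋ : ∀ i {x} → x ∈ˢ lookup blocks i → T (to index↔ i ∋ x)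
      ∈⇒∋ i {x} x∈ = subst T (lookup∘tabulate _ x) (∈ˢ⇒T (subst (x ∈ˢ_) (lookup-blocks i) x∈))
      ∋⇒∈ : ∀ i {x} → T (to index↔ i ∋ x) → x ∈ˢ lookup blocks i
      ∋⇒∈ i {x} t = subst (x ∈ˢ_) (sym (lookup-blocks i)) (T⇒∈ˢ (subst T (sym (lookup∘tabulate _ x)) t))
      cover : ∀ x y → grp x ≢ grp y → Σ (Fin (length blocks)) λ i →
        (x ∈ˢ lookup blocks i × y ∈ˢ lookup blocks i) ×
        (∀ j → x ∈ˢ lookup blocks j → y ∈ˢ lookup blocks j → j ≡ i)
      cover x y ne = let (B , (px , py) , uniq) = pair-cover x y ne
                         i = from index↔ B
                         B≡ = strictlyInverseˡ index↔ B in
        i , (∋⇒∈ i (subst (λ B → T (B ∋ x)) (sym B≡) px) ,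
             ∋⇒∈ i (subst (λ B → T (B ∋ y)) (sym B≡) py)) ,
        λ j pj qj → to-injective index↔ (trans (sym (uniq (∈⇒∋ j pj , ∈⇒∋ j qj))) (sym B≡))

  module _ {k a b : ℕ} where
    private
      groups = groups↔ k a b
      points = Points↔ k a b

    GDD⇒PointsDesign : GDD K (type k a b) → BlockDesign K (groupOf {k} {a} {b})
    GDD⇒PointsDesign G = BlockDesign-map (↔-sym (points ↔-∘ GDD-points↔ G)) (to groups) (to-injective groups)
      compat (GDD⇒BlockDesign G)
      where
        compat : ∀ x → groupOf x ≡ to groups (GDD.grp G (from (GDD-points↔ G) (from points x)))
        compat x = begin
          groupOf x                                 ≡⟨ cong groupOf (strictlyInverseˡ points x) ⟨
          groupOf (to points (from points x))       ≡⟨ groupOf-Points↔ k a b _ ⟩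
          to groups (proj₁ (from points x))
            ≡⟨ cong (to groups ∘ proj₁) (strictlyInverseˡ (GDD-points↔ G) _) ⟨
          to groups (GDD.grp G (from (GDD-points↔ G) (from points x))) ∎
          where open ≡-Reasoning

    PointsDesign⇒GDD : BlockDesign K (groupOf {k} {a} {b}) → GDD K (type k a b)
    PointsDesign⇒GDD D = BlockDesign⇒GDD
      (BlockDesign-map (points ↔-∘ sum↔Σ (type k a b)) (from groups) (to-injective (↔-sym groups)) compat D)
      where
        compat : ∀ x → proj₁ (to (sum↔Σ (type k a b)) x) ≡
                       from groups (groupOf (to points (to (sum↔Σ (type k a b)) x)))
        compat x = trans (sym (strictlyInverseʳ groups _)) (cong (from groups) (sym (groupOf-Points↔ k a b _)))

-- Orthogonal arrays

-- An orthogonal array OA(k,n): the blocks of a TD(k,n) as rows, one entry per group.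
record OA (k n : ℕ) : Set where
  field
    #rows      : ℕ
    entry      : Fin #rows → Fin k → Fin n
    unique-row : ∀ {c c'} → c ≢ c' → ∀ i i' → ∃! _≡_ (λ r → entry r c ≡ i × entry r c' ≡ i')

module TD⇒OA {k n : ℕ} (G : TD k n) where
  open GDD G

  group : Fin k → Fin (length (replicate k n))
  group = cast (sym (length-replicate k))

  group↔ : ∀ c → Sat (λ x → does (grp x ≟ group c)) ↔ Fin n
  group↔ c = cast-id (lookup-replicate k n c) ↔-∘ GDD-fibre↔ G (group c)

  point : Fin k → Fin n → Fin (sum (replicate k n))
  point c i = proj₁ (from (group↔ c) i)

  grp-point : ∀ c i → grp (point c i) ≡ group c
  grp-point c i = T-does⇒ (grp (point c i) ≟ group c) (proj₂ (from (group↔ c) i))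

  -- The k points of a block lie in distinct groups, hence in all k groups.
  block-meets-group : ∀ b c → ∃[ x ] x ∈ˢ lookup blocks b × grp x ≡ group c
  block-meets-group b c = let (r , r↦c) = injective⇒surjective column-of column-of-injective c in
    member r , member∈ r ,
    trans (sym (cast-involutive (sym (length-replicate k)) (length-replicate k) (grp (member r)))) (cong group r↦c)
    where
      member↔ : Sat (Vec.lookup (lookup blocks b)) ↔ Fin k
      member↔ = cast-id (block-size b) ↔-∘ Sat-lookup↔ (lookup blocks b)
      member : Fin k → Fin (sum (replicate k n))
      member r = proj₁ (from member↔ r)
      member∈ : ∀ r → member r ∈ˢ lookup blocks b
      member∈ r = T⇒∈ˢ (proj₂ (from member↔ r))
      column-of : Fin k → Fin k
      column-of r = cast (length-replicate k) (grp (member r))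
      column-of-injective : Injective _≡_ _≡_ column-of
      column-of-injective {r} {r'} eq = to-injective (↔-sym member↔) (Sat-≡ {P = Vec.lookup (lookup blocks b)}
        (block-transversal b _ _ (member∈ r) (member∈ r') (to-injective (cast-id (length-replicate k)) eq)))

  meet : Fin (length blocks) → Fin k → Fin (sum (replicate k n))
  meet b c = proj₁ (block-meets-group b c)

  grp-meet : ∀ b c → grp (meet b c) ≡ group c
  grp-meet b c = proj₂ (proj₂ (block-meets-group b c))

  entry : Fin (length blocks) → Fin k → Fin n
  entry b c = to (group↔ c) (meet b c , ⇒T-does (grp (meet b c) ≟ group c) (grp-meet b c))

  entry⇒∈ : ∀ b c {i} → entry b c ≡ i → point c i ∈ˢ lookup blocks b
  entry⇒∈ b c {i} e = subst (_∈ˢ lookup blocks b) meet≡point (proj₁ (proj₂ (block-meets-group b c)))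
    where
      meet≡point : meet b c ≡ point c i
      meet≡point = cong proj₁ (trans (sym (strictlyInverseʳ (group↔ c) _)) (cong (from (group↔ c)) e))

  ∈⇒entry : ∀ b c i → point c i ∈ˢ lookup blocks b → entry b c ≡ i
  ∈⇒entry b c i p∈b =
    trans (cong (to (group↔ c)) (Sat-≡ {P = λ x → does (grp x ≟ group c)} meet≡point))
          (strictlyInverseˡ (group↔ c) i)
    where
      meet≡point : meet b c ≡ point c i
      meet≡point = block-transversal b _ _ (proj₁ (proj₂ (block-meets-group b c))) p∈b
        (trans (grp-meet b c) (sym (grp-point c i)))

  oa : OA k n
  oa = record { #rows = length blocks ; entry = entry ; unique-row = unique-row }
    where
      unique-row : ∀ {c c'} → c ≢ c' → ∀ i i' → ∃! _≡_ (λ r → entry r c ≡ i × entry r c' ≡ i')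
      unique-row {c} {c'} c≢c' i i' =
        let (b , (p∈b , p'∈b) , uniq) = pair-cover (point c i) (point c' i') different-groups
        in b , (∈⇒entry b c i p∈b , ∈⇒entry b c' i' p'∈b) ,
           λ (e , e') → sym (uniq _ (entry⇒∈ _ c e) (entry⇒∈ _ c' e'))
        where
          different-groups : grp (point c i) ≢ grp (point c' i')
          different-groups eq = c≢c' (to-injective (cast-id (sym (length-replicate k)))
            (trans (sym (grp-point c i)) (trans eq (grp-point c' i'))))

rows-agreeing-twice : {k n : ℕ} (O : OA k n) → let open OA O in
  ∀ {c c'} → c ≢ c' → ∀ r r' → entry r c ≡ entry r' c → entry r c' ≡ entry r' c' → r ≡ r'
rows-agreeing-twice O c≢c' r r' same same' =
  let (_ , _ , uniq) = unique-row c≢c' (entry r' _) (entry r' _) in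
  trans (sym (uniq (same , same'))) (uniq (refl , refl))
  where open OA O

DisjointRows : {k n : ℕ} → OA k n → ℕ → Set
DisjointRows O α = Σ (Fin α → Fin #rows) λ D →
  ∀ {s s'} → s ≢ s' → ∀ c → entry (D s) c ≢ entry (D s') c
  where open OA O

TD-disjoint⇒OA : {k n α : ℕ} → TDWithDisjointBlocks k n α → Σ (OA k n) λ O → DisjointRows O α
TD-disjoint⇒OA (G , D , _ , disjoint) = oa , D , λ s≢s' c same →
  disjoint _ _ s≢s' (point c _) (entry⇒∈ (D _) c refl) (entry⇒∈ (D _) c (sym same))
  where open TD⇒OA G

-- Fillings

Present : {ℓ u v : ℕ} → Bool → Points ℓ u v → Set
Present long (inj₁ _) = ⊤
Present long (inj₂ _) = T long

SameHole : {ℓ u v : ℕ} → (Fin u → Bool) → Points ℓ u v → Points ℓ u v → Set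
SameHole H (inj₁ (_ , f)) (inj₁ (_ , f')) = f ≡ f' × T (H f)
SameHole H _ _ = ⊥

-- An incomplete K-GDD of type uˡ v¹ (without the v points unless `long`): for each f with H f, the
-- points (j , f), j < ℓ, form a hole, whose pairs are covered by no block.
record Filling (K : ℕ → Set) (ℓ u v : ℕ) (long : Bool) (H : Fin u → Bool) : Set₁ where
  field
    Block       : Set
    #blocks     : ℕ
    block↔      : Block ↔ Fin #blocks
    _∋_         : Block → Points ℓ u v → Bool
    long-absent : ∀ B g → T (B ∋ inj₂ g) → T long
    block-size  : ∀ B → ∃[ k ] K k × (Sat (B ∋_) ↔ Fin k)
    transversal : ∀ B x y → T (B ∋ x) → T (B ∋ y) → groupOf x ≡ groupOf y → x ≡ y
    hole-free   : ∀ B j j' f → T (H f) → T (B ∋ inj₁ (j , f)) → T (B ∋ inj₁ (j' , f)) → j ≡ j'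
    pair-cover  : ∀ x y → Present long x → Present long y → groupOf x ≢ groupOf y → ¬ SameHole H x y →
                  ∃! _≡_ (λ B → T (B ∋ x) × T (B ∋ y))

GDD⇒Filling : {K : ℕ → Set} {ℓ u v : ℕ} → GDD K (type ℓ u v) →
  (H : Fin u → Bool) → (∀ f → ¬ T (H f)) → Filling K ℓ u v true H
GDD⇒Filling G H no-holes = record
  { Block = Block ; #blocks = #blocks ; block↔ = block↔ ; _∋_ = _∋_
  ; long-absent = λ _ _ _ → tt
  ; block-size = block-size ; transversal = transversal
  ; hole-free = λ _ _ _ f hole → ⊥-elim (no-holes f hole)
  ; pair-cover = λ x y _ _ ne _ → pair-cover x y ne
  }
  where open BlockDesign (GDD⇒PointsDesign G)

-- The holes H are removed rows of O: hole f is the disjoint row number slot f.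
module OA⇒Filling {K : ℕ → Set} {ℓ u v α : ℕ} (O : OA ℓ u) (rows : DisjointRows O α) (H : Fin u → Bool)
  (slot : Fin u → Fin α) (slot-injective : ∀ f f' → T (H f) → T (H f') → slot f ≡ slot f' → f ≡ f')
  (Kℓ : K ℓ) where

  open OA O
  D = proj₁ rows

  hole-row : Fin u → Fin #rows
  hole-row f = D (slot f)

  hole-rows-injective : ∀ j f f' → T (H f) → T (H f') →
    entry (hole-row f) j ≡ entry (hole-row f') j → f ≡ f'
  hole-rows-injective j f f' Hf Hf' same with slot f ≟ slot f'
  ... | yes eq = slot-injective f f' Hf Hf' eq
  ... | no ne = ⊥-elim (proj₂ rows ne j same)

  -- Relabel column j so that hole f sits where the hole row of f meets column j.
  relabel : Fin ℓ → Permutation′ u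
  relabel j = proj₁ (extend-injection H (λ f → entry (hole-row f) j) (hole-rows-injective j))

  relabel-hole : ∀ j f → T (H f) → relabel j ⟨$⟩ʳ f ≡ entry (hole-row f) j
  relabel-hole j = proj₂ (extend-injection H (λ f → entry (hole-row f) j) (hole-rows-injective j))

  IsHoleRow : Fin #rows → Set
  IsHoleRow r = ∃[ f ] T (H f) × hole-row f ≡ r

  isHoleRow? : ∀ r → Dec (IsHoleRow r)
  isHoleRow? r = any? (λ f → T? (H f) ×-dec (hole-row f ≟ r))

  Block : Set
  Block = Sat (not ∘ does ∘ isHoleRow?)

  block-not-hole : ∀ (B : Block) → ¬ IsHoleRow (proj₁ B)
  block-not-hole (r , kept) hole with isHoleRow? r
  ... | yes _ = kept
  ... | no ¬hole = ¬hole hole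

  not-hole⇒block : ∀ r → ¬ IsHoleRow r → T (not (does (isHoleRow? r)))
  not-hole⇒block r ¬hole with isHoleRow? r
  ... | yes hole = ¬hole hole
  ... | no _ = tt

  _∋_ : Block → Points ℓ u v → Bool
  (r , _) ∋ inj₁ (j , f) = does (relabel j ⟨$⟩ʳ f ≟ entry r j)
  (r , _) ∋ inj₂ _ = false

  ∋⇒entry : ∀ B j f → T (B ∋ inj₁ (j , f)) → relabel j ⟨$⟩ʳ f ≡ entry (proj₁ B) j
  ∋⇒entry (r , _) j f = T-does⇒ (relabel j ⟨$⟩ʳ f ≟ entry r j)

  entry⇒∋ : ∀ B j f → relabel j ⟨$⟩ʳ f ≡ entry (proj₁ B) j → T (B ∋ inj₁ (j , f))
  entry⇒∋ (r , _) j f = ⇒T-does (relabel j ⟨$⟩ʳ f ≟ entry r j)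

  block↔ℓ : ∀ B → Sat (B ∋_) ↔ Fin ℓ
  block↔ℓ B@(r , _) = mk↔ₛ′ (λ { (inj₁ (j , _) , _) → j ; (inj₂ _ , ()) })
    (λ j → inj₁ (j , relabel j ⟨$⟩ˡ entry r j) , entry⇒∋ B j _ (strictlyInverseˡ (relabel j) _))
    (λ _ → refl)
    (λ { (inj₁ (j , f) , f∈B) → Sat-≡ (cong (λ f → inj₁ (j , f))
           (trans (cong (relabel j ⟨$⟩ˡ_) (sym (∋⇒entry B j f f∈B))) (strictlyInverseʳ (relabel j) f)))
       ; (inj₂ _ , ()) })

  transversal : ∀ B x y → T (B ∋ x) → T (B ∋ y) → groupOf x ≡ groupOf y → x ≡ y
  transversal B (inj₁ (j , f)) (inj₁ (.j , f')) x∈B y∈B refl =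
    cong (λ f → inj₁ (j , f))
      (to-injective (relabel j) (trans (∋⇒entry B j f x∈B) (sym (∋⇒entry B j f' y∈B))))
  transversal (_ , _) (inj₁ _) (inj₂ _) _ () _
  transversal (_ , _) (inj₂ _) _ () _ _

  hole-free : ∀ B j j' f → T (H f) → T (B ∋ inj₁ (j , f)) → T (B ∋ inj₁ (j' , f)) → j ≡ j'
  hole-free B j j' f Hf f∈B f'∈B with j ≟ j'
  ... | yes j≡j' = j≡j'
  ... | no j≢j' = ⊥-elim (block-not-hole B (f , Hf , rows-agreeing-twice O j≢j' _ _
          (trans (sym (relabel-hole j f Hf)) (∋⇒entry B j f f∈B))
          (trans (sym (relabel-hole j' f Hf)) (∋⇒entry B j' f f'∈B))))

  pair-cover : ∀ x y → Present false x → Present false y → groupOf x ≢ groupOf y → ¬ SameHole H x y →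
    ∃! _≡_ (λ B → T (B ∋ x) × T (B ∋ y))
  pair-cover (inj₁ (j , f)) (inj₁ (j' , f')) _ _ different ¬same =
    B₀ , (entry⇒∋ B₀ j f e , entry⇒∋ B₀ j' f' e') ,
    λ {B} (x∈B , y∈B) → Sat-≡ (uniq (sym (∋⇒entry B j f x∈B) , sym (∋⇒entry B j' f' y∈B)))
    where
      j≢j' : j ≢ j'
      j≢j' refl = different refl
      row = unique-row j≢j' (relabel j ⟨$⟩ʳ f) (relabel j' ⟨$⟩ʳ f')
      r₀ = proj₁ row
      e = sym (proj₁ (proj₁ (proj₂ row)))
      e' = sym (proj₂ (proj₁ (proj₂ row)))
      uniq = proj₂ (proj₂ row)
      r₀-not-hole : ¬ IsHoleRow r₀
      r₀-not-hole (g , Hg , hole≡r₀) = ¬same (trans f≡g (sym f'≡g) , subst (T ∘ H) (sym f≡g) Hg)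
        where
          at-hole : ∀ c {h} → relabel c ⟨$⟩ʳ h ≡ entry r₀ c → h ≡ g
          at-hole c eq = to-injective (relabel c)
            (trans eq (sym (trans (relabel-hole c g Hg) (cong (λ r → entry r c) hole≡r₀))))
          f≡g = at-hole j e
          f'≡g = at-hole j' e'
      B₀ : Block
      B₀ = r₀ , not-hole⇒block r₀ r₀-not-hole
  pair-cover (inj₁ _) (inj₂ _) _ () _ _
  pair-cover (inj₂ _) _ () _ _ _

  filling : Filling K ℓ u v false H
  filling = record
    { Block = Block ; #blocks = _ ; block↔ = Sat↔Fin _ ; _∋_ = _∋_
    ; long-absent = λ { (_ , _) _ () }
    ; block-size = λ B → ℓ , Kℓ , block↔ℓ B
    ; transversal = transversal ; hole-free = hole-free ; pair-cover = pair-cover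
    }

-- The construction

pattern col j i f = inj₁ (j , i , f)
pattern lng z g   = inj₂ (inj₁ (z , g))
pattern ∞         = inj₂ (inj₂ tt)

pattern pbd j c  = inj₁ (j , c)
pattern fill r B = inj₂ (r , B)

-- Column zero of O is the group that is not inflated; its points z with long z carry v long points each,
-- the others carry holes.
module Construction {K : ℕ → Set} {ℓ m u v t : ℕ} (c₀ : Fin ℓ) (O : OA (suc ℓ) m) (P : PBD (m * u + 1) K)
  (long : Fin m → Bool) (long↔ : Sat long ↔ Fin t) (hole-point : Fin u → Fin m)
  (filling : ∀ z → Filling K ℓ u v (long z) (λ f → does (hole-point f ≟ z))) where

  open OA O

  row : Fin ℓ → Fin m → Fin m → Fin #rows
  row j i z = proj₁ (unique-row {suc j} {zero} (λ ()) i z)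

  row-col : ∀ j i z → entry (row j i z) (suc j) ≡ i
  row-col j i z = proj₁ (proj₁ (proj₂ (unique-row {suc j} {zero} (λ ()) i z)))

  row-zero : ∀ j i z → entry (row j i z) zero ≡ z
  row-zero j i z = proj₂ (proj₁ (proj₂ (unique-row {suc j} {zero} (λ ()) i z)))

  row-unique : ∀ j i z r → entry r (suc j) ≡ i → entry r zero ≡ z → row j i z ≡ r
  row-unique j i z r e e' = proj₂ (proj₂ (unique-row {suc j} {zero} (λ ()) i z)) (e , e')

  -- The group of size ℓ containing (j , i , f) is hole f of the row through (j , i) and hole-point f;
  -- that row is named by its entry in column c₀.
  hole-group : Fin ℓ → Fin m → Fin u → Fin m
  hole-group j i f = entry (row j i (hole-point f)) (suc c₀)

  hole-group-row : ∀ j i f → row c₀ (hole-group j i f) (hole-point f) ≡ row j i (hole-point f)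
  hole-group-row j i f = row-unique c₀ _ _ _ refl (row-zero j i (hole-point f))

  hole-group-entry : ∀ j i f → entry (row c₀ (hole-group j i f) (hole-point f)) (suc j) ≡ i
  hole-group-entry j i f = trans (cong (λ r → entry r (suc j)) (hole-group-row j i f)) (row-col j i (hole-point f))

  entry-hole-group : ∀ j i₀ f → hole-group j (entry (row c₀ i₀ (hole-point f)) (suc j)) f ≡ i₀
  entry-hole-group j i₀ f =
    trans (cong (λ r → entry r (suc c₀)) (row-unique j _ _ _ refl (row-zero c₀ i₀ (hole-point f))))
          (row-col c₀ i₀ (hole-point f))

  LongPoint : Set
  LongPoint = Sat long × Fin v

  Point : Set
  Point = (Fin ℓ × Fin m × Fin u) ⊎ (LongPoint ⊎ ⊤)

  Group : Set
  Group = (Fin m × Fin u) ⊎ ⊤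

  group : Point → Group
  group (col j i f) = inj₁ (hole-group j i f , f)
  group (inj₂ _) = inj₂ tt

  mu↔ : Fin (m * u) ↔ (Fin m × Fin u)
  mu↔ = *↔× {m} {u}

  long↔Fin : (LongPoint ⊎ ⊤) ↔ Fin (t * v + 1)
  long↔Fin = ↔-sym +↔⊎ ↔-∘ ((↔-sym *↔× ↔-∘ (long↔ ×-↔ ↔-id _)) ⊎-↔ ↔-sym 1↔⊤)

  Point↔ : Point ↔ Points (m * u) ℓ (t * v + 1)
  Point↔ = mk↔ₛ′ into outof into∘outof outof∘into
    where
      into : Point → Points (m * u) ℓ (t * v + 1)
      into (col j i f) = inj₁ (from mu↔ (hole-group j i f , f) , j)
      into (inj₂ x) = inj₂ (to long↔Fin x)
      outof : Points (m * u) ℓ (t * v + 1) → Point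
      outof (inj₁ (g , j)) = let (i₀ , f) = to mu↔ g in col j (entry (row c₀ i₀ (hole-point f)) (suc j)) f
      outof (inj₂ y) = inj₂ (from long↔Fin y)
      into∘outof : ∀ y → into (outof y) ≡ y
      into∘outof (inj₁ (g , j)) = cong (λ g → inj₁ (g , j))
        (trans (cong (λ i₀ → from mu↔ (i₀ , _)) (entry-hole-group j _ _)) (strictlyInverseʳ mu↔ g))
      into∘outof (inj₂ y) = cong inj₂ (strictlyInverseˡ long↔Fin y)
      outof∘into : ∀ x → outof (into x) ≡ x
      outof∘into (col j i f) =
        trans (cong (λ (i₀ , f) → col j (entry (row c₀ i₀ (hole-point f)) (suc j)) f)
                    (strictlyInverseˡ mu↔ (hole-group j i f , f)))
              (cong (λ i → col j i f) (hole-group-entry j i f))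
      outof∘into (inj₂ x) = cong inj₂ (strictlyInverseʳ long↔Fin x)

  group-index : Group → Fin (m * u) ⊎ ⊤
  group-index = Sum.map₁ (from mu↔)

  group-index-injective : ∀ {g h} → group-index g ≡ group-index h → g ≡ h
  group-index-injective {inj₁ _} {inj₁ _} eq = cong inj₁ (to-injective (↔-sym mu↔) (inj₁-injective eq))
  group-index-injective {inj₂ tt} {inj₂ tt} _ = refl

  group-Point↔ : ∀ x → groupOf (to Point↔ x) ≡ group-index (group x)
  group-Point↔ (col _ _ _) = refl
  group-Point↔ (inj₂ _) = refl

  module P = PBD P
  module F (r : Fin #rows) = Filling (filling (entry r zero))

  -- Column j together with ∞ carries a copy of the PBD; row r carries the filling at its entry in column zero.
  Block : Set
  Block = (Fin ℓ × Fin (length P.blocks)) ⊎ Σ (Fin #rows) F.Block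

  Block↔ : Block ↔ Fin (ℓ * length P.blocks + sum (List.tabulate (λ r → F.#blocks r)))
  Block↔ = ↔-sym +↔⊎ ↔-∘
    (↔-sym *↔× ⊎-↔ (Σ-Fin↔ (λ r → F.#blocks r) ↔-∘ Σ-↔ (↔-id _) (F.block↔ _)))

  pbd↔ : ((Fin m × Fin u) ⊎ ⊤) ↔ Fin (m * u + 1)
  pbd↔ = ↔-sym +↔⊎ ↔-∘ (↔-sym mu↔ ⊎-↔ ↔-sym 1↔⊤)

  _∈ᴾ_ : (Fin m × Fin u) ⊎ ⊤ → Fin (length P.blocks) → Bool
  y ∈ᴾ c = Vec.lookup (lookup P.blocks c) (to pbd↔ y)

  _∋_ : Block → Point → Bool
  pbd j c ∋ col j' i f = does (j ≟ j') ∧ (inj₁ (i , f) ∈ᴾ c)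
  pbd j c ∋ lng _ _ = false
  pbd j c ∋ ∞ = inj₂ tt ∈ᴾ c
  fill r B ∋ col j i f = does (entry r (suc j) ≟ i) ∧ F._∋_ r B (inj₁ (j , f))
  fill r B ∋ lng (z , _) g = does (entry r zero ≟ z) ∧ F._∋_ r B (inj₂ g)
  fill r B ∋ ∞ = false

  pbd∈ : ∀ j c j' {i f} → T (pbd j c ∋ col j' i f) → j ≡ j' × T (inj₁ (i , f) ∈ᴾ c)
  pbd∈ j c j' p = let (p₁ , p₂) = Equivalence.to T-∧ p in T-does⇒ (j ≟ j') p₁ , p₂

  ∈pbd : ∀ j {c i f} → T (inj₁ (i , f) ∈ᴾ c) → T (pbd j c ∋ col j i f)
  ∈pbd j p = Equivalence.from T-∧ (⇒T-does (j ≟ j) refl , p)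

  fill∈ : ∀ r B j i {f} → T (fill r B ∋ col j i f) → entry r (suc j) ≡ i × T (F._∋_ r B (inj₁ (j , f)))
  fill∈ r B j i p = let (p₁ , p₂) = Equivalence.to T-∧ p in T-does⇒ (entry r (suc j) ≟ i) p₁ , p₂

  ∈fill : ∀ {r B j i f} → entry r (suc j) ≡ i → T (F._∋_ r B (inj₁ (j , f))) → T (fill r B ∋ col j i f)
  ∈fill {r} {j = j} {i} e p = Equivalence.from T-∧ (⇒T-does (entry r (suc j) ≟ i) e , p)

  fill∈-long : ∀ r B z {g} → T (fill r B ∋ lng z g) → entry r zero ≡ proj₁ z × T (F._∋_ r B (inj₂ g))
  fill∈-long r B (z , _) p = let (p₁ , p₂) = Equivalence.to T-∧ p in T-does⇒ (entry r zero ≟ z) p₁ , p₂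

  ∈fill-long : ∀ {r B} z {g} → entry r zero ≡ proj₁ z → T (F._∋_ r B (inj₂ g)) → T (fill r B ∋ lng z g)
  ∈fill-long {r} (z , _) e p = Equivalence.from T-∧ (⇒T-does (entry r zero ≟ z) e , p)

  pbd-block↔ : ∀ j c → Sat (pbd j c ∋_) ↔ Sat (_∈ᴾ c)
  pbd-block↔ j c = mk↔ₛ′ into outof (λ { (inj₁ _ , _) → Sat-≡ refl ; (inj₂ tt , _) → refl }) outof∘into
    where
      into : Sat (pbd j c ∋_) → Sat (_∈ᴾ c)
      into (col j' i f , p) = inj₁ (i , f) , proj₂ (pbd∈ j c j' p)
      into (∞ , p) = inj₂ tt , p
      outof : Sat (_∈ᴾ c) → Sat (pbd j c ∋_)
      outof (inj₁ (i , f) , p) = col j i f , ∈pbd j p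
      outof (inj₂ tt , p) = ∞ , p
      outof∘into : ∀ x → outof (into x) ≡ x
      outof∘into (col j' i f , p) = Sat-≡ (cong (λ j → col j i f) (proj₁ (pbd∈ j c j' p)))
      outof∘into (∞ , p) = refl

  fill-block↔ : ∀ r B → Sat (fill r B ∋_) ↔ Sat (F._∋_ r B)
  fill-block↔ r B =
    mk↔ₛ′ into outof (λ { (inj₁ _ , _) → Sat-≡ refl ; (inj₂ _ , _) → Sat-≡ refl }) outof∘into
    where
      into : Sat (fill r B ∋_) → Sat (F._∋_ r B)
      into (col j i f , p) = inj₁ (j , f) , proj₂ (fill∈ r B j i p)
      into (lng z g , p) = inj₂ g , proj₂ (fill∈-long r B z p)
      outof : Sat (F._∋_ r B) → Sat (fill r B ∋_)
      outof (inj₁ (j , f) , p) = col j (entry r (suc j)) f , ∈fill refl p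
      outof (inj₂ g , p) = lng z g , ∈fill-long z refl p
        where z = entry r zero , F.long-absent r B g p
      outof∘into : ∀ x → outof (into x) ≡ x
      outof∘into (col j i f , p) = Sat-≡ (cong (λ i → col j i f) (proj₁ (fill∈ r B j i p)))
      outof∘into (lng z g , p) = Sat-≡ (cong (λ z → lng z g) (Sat-≡ (proj₁ (fill∈-long r B z p))))

  block-size : ∀ B → ∃[ k ] K k × (Sat (B ∋_) ↔ Fin k)
  block-size (pbd j c) =
    _ , P.block-size c , Sat-lookup↔ (lookup P.blocks c) ↔-∘ (Sat-∘↔ pbd↔ _ ↔-∘ pbd-block↔ j c)
  block-size (fill r B) = let (k , Kk , B↔k) = F.block-size r B in k , Kk , B↔k ↔-∘ fill-block↔ r B

  same-group⇒same-row : ∀ {j i f j' i' f'} → group (col j i f) ≡ group (col j' i' f') →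
    f ≡ f' × row j i (hole-point f) ≡ row j' i' (hole-point f')
  same-group⇒same-row {j} {i} {f} {j'} {i'} same with ×-≡,≡←≡ (inj₁-injective same)
  ... | same-hole-group , refl = refl , (begin
    row j i (hole-point f)                    ≡⟨ hole-group-row j i f ⟨
    row c₀ (hole-group j i f) (hole-point f)  ≡⟨ cong (λ i₀ → row c₀ i₀ (hole-point f)) same-hole-group ⟩
    row c₀ (hole-group j' i' f) (hole-point f) ≡⟨ hole-group-row j' i' f ⟩
    row j' i' (hole-point f)                  ∎)
    where open ≡-Reasoning

  transversal : ∀ B x y → T (B ∋ x) → T (B ∋ y) → group x ≡ group y → x ≡ y
  transversal (pbd j c) (col j₁ i f) (col j₂ i' f') x∈B y∈B same
    with refl , _ ← pbd∈ j c j₁ x∈B | refl , _ ← pbd∈ j c j₂ y∈B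
       | refl , same-row ← same-group⇒same-row same =
    cong (λ i → col j i f)
      (trans (sym (row-col j i _)) (trans (cong (λ r → entry r (suc j)) same-row) (row-col j i' _)))
  transversal (fill r B) (col j i f) (col j' i' f') x∈B y∈B same
    with r-at-i , x∈B' ← fill∈ r B j i x∈B | r-at-i' , y∈B' ← fill∈ r B j' i' y∈B
       | refl , same-row ← same-group⇒same-row same | j ≟ j'
  ... | yes refl = cong (λ i → col j i f) (trans (sym r-at-i) r-at-i')
  ... | no j≢j' = ⊥-elim (j≢j' (F.hole-free r B j j' f f-is-hole x∈B' y∈B'))
    where
      -- r and the row carrying the group of x agree in the columns of x and y.
      r≡row : r ≡ row j i (hole-point f)
      r≡row = rows-agreeing-twice O (j≢j' ∘ suc-injective) r (row j i (hole-point f))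
        (trans r-at-i (sym (row-col j i _)))
        (trans r-at-i' (sym (trans (cong (λ r → entry r (suc j')) same-row) (row-col j' i' _))))
      f-is-hole : T (does (hole-point f ≟ entry r zero))
      f-is-hole = ⇒T-does (hole-point f ≟ _) (sym (trans (cong (λ r → entry r zero) r≡row) (row-zero j i _)))
  transversal (fill r B) (lng z₁ g₁) (lng z₂ g₂) x∈B y∈B _
    with r-at-z₁ , x∈B' ← fill∈-long r B z₁ x∈B | r-at-z₂ , y∈B' ← fill∈-long r B z₂ y∈B
    with refl ← trans (sym r-at-z₁) r-at-z₂
       | refl ← F.transversal r B (inj₂ g₁) (inj₂ g₂) x∈B' y∈B' refl =
    cong (λ z → lng z g₁) (Sat-≡ refl)
  transversal (pbd _ _) (col _ _ _) ∞ _ _ ()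
  transversal (pbd _ _) ∞ (col _ _ _) _ _ ()
  transversal (pbd _ _) ∞ ∞ _ _ _ = refl
  transversal (fill _ _) (col _ _ _) (lng _ _) _ _ ()
  transversal (fill _ _) (lng _ _) (col _ _ _) _ _ ()

  Joined : Point → Point → Block → Set
  Joined x y B = T (B ∋ x) × T (B ∋ y)

  swap-joined : ∀ {x y} → ∃! _≡_ (Joined x y) → ∃! _≡_ (Joined y x)
  swap-joined (B , (x∈B , y∈B) , uniq) = B , (y∈B , x∈B) , λ (y∈B' , x∈B') → uniq (x∈B' , y∈B')

  fill-≡ : ∀ {r r'} (B : F.Block r) (B' : F.Block r') {x y} →
    (∀ {B''} → T (F._∋_ r B'' x) × T (F._∋_ r B'' y) → B ≡ B'') →
    r ≡ r' → T (F._∋_ r' B' x) × T (F._∋_ r' B' y) → _≡_ {A = Block} (fill r B) (fill r' B')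
  fill-≡ B B' uniq refl joined = cong (fill _) (uniq joined)

  pbd-cover : ∀ {a b} → a ≢ b → ∃! _≡_ (λ c → T (a ∈ᴾ c) × T (b ∈ᴾ c))
  pbd-cover a≢b = let (c , (a∈c , b∈c) , uniq) = P.pair-cover _ _ (a≢b ∘ to-injective pbd↔) in
    c , (∈ˢ⇒T a∈c , ∈ˢ⇒T b∈c) , λ (a∈c' , b∈c') → sym (uniq _ (T⇒∈ˢ a∈c') (T⇒∈ˢ b∈c'))

  cover-same-column : ∀ j i f i' f' → group (col j i f) ≢ group (col j i' f') →
    ∃! _≡_ (Joined (col j i f) (col j i' f'))
  cover-same-column j i f i' f' different =
    let (c , (x∈c , y∈c) , uniq) = pbd-cover {inj₁ (i , f)} {inj₁ (i' , f')} different-points in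
    pbd j c , (∈pbd j x∈c , ∈pbd j y∈c) , unique c uniq
    where
      different-points : inj₁ (i , f) ≢ inj₁ (i' , f')
      different-points eq = different (cong (λ (i , f) → group (col j i f)) (inj₁-injective eq))
      unique : ∀ c → (∀ {c'} → T (inj₁ (i , f) ∈ᴾ c') × T (inj₁ (i' , f') ∈ᴾ c') → c ≡ c') →
        ∀ {B} → Joined (col j i f) (col j i' f') B → pbd j c ≡ B
      unique c uniq {pbd j₂ c'} (x∈B , y∈B) with refl , x∈c' ← pbd∈ j₂ c' j x∈B =
        cong (pbd j) (uniq (x∈c' , proj₂ (pbd∈ j c' j y∈B)))
      unique c uniq {fill r B} (x∈B , y∈B)
        with r-at-i , x∈B' ← fill∈ r B j i x∈B | r-at-i' , y∈B' ← fill∈ r B j i' y∈B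
        with refl ← trans (sym r-at-i) r-at-i' | refl ← F.transversal r B _ _ x∈B' y∈B' refl =
        ⊥-elim (different refl)

  cover-column-∞ : ∀ j i f → ∃! _≡_ (Joined (col j i f) ∞)
  cover-column-∞ j i f =
    let (c , (x∈c , ∞∈c) , uniq) = pbd-cover {inj₁ (i , f)} {inj₂ tt} (λ ()) in
    pbd j c , (∈pbd j x∈c , ∞∈c) , λ
      { {pbd j₂ c'} (x∈B , ∞∈B) →
          let (j₂≡j , x∈c') = pbd∈ j₂ c' j x∈B in cong₂ pbd (sym j₂≡j) (uniq (x∈c' , ∞∈B))
      ; {fill _ _} (_ , ()) }

  cover-across : ∀ j i f j' i' f' → j ≢ j' → group (col j i f) ≢ group (col j' i' f') →
    ∃! _≡_ (Joined (col j i f) (col j' i' f'))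
  cover-across j i f j' i' f' j≢j' different = fill r B₀ , (∈fill e x∈B₀ , ∈fill e' y∈B₀) , unique
    where
      through = unique-row {suc j} {suc j'} (j≢j' ∘ suc-injective) i i'
      r = proj₁ through
      e = proj₁ (proj₁ (proj₂ through))
      e' = proj₂ (proj₁ (proj₂ through))
      not-hole : ¬ SameHole {v = v} (λ f → does (hole-point f ≟ entry r zero)) (inj₁ (j , f)) (inj₁ (j' , f'))
      not-hole (refl , hole) = different (cong (λ r → inj₁ (entry r (suc c₀) , f))
        (trans (row-unique j i _ r e hole-at-r) (sym (row-unique j' i' _ r e' hole-at-r))))
        where hole-at-r = sym (T-does⇒ (hole-point f ≟ entry r zero) hole)
      filled = F.pair-cover r (inj₁ (j , f)) (inj₁ (j' , f')) tt tt (j≢j' ∘ inj₁-injective) not-hole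
      B₀ = proj₁ filled
      x∈B₀ = proj₁ (proj₁ (proj₂ filled))
      y∈B₀ = proj₂ (proj₁ (proj₂ filled))
      unique : ∀ {B} → Joined (col j i f) (col j' i' f') B → fill r B₀ ≡ B
      unique {pbd j₂ c} (x∈B , y∈B) =
        ⊥-elim (j≢j' (trans (sym (proj₁ (pbd∈ j₂ c j x∈B))) (proj₁ (pbd∈ j₂ c j' y∈B))))
      unique {fill r' B} (x∈B , y∈B) =
        let (r'-at-i , x∈B') = fill∈ r' B j i x∈B ; (r'-at-i' , y∈B') = fill∈ r' B j' i' y∈B in
        fill-≡ B₀ B (proj₂ (proj₂ filled)) (proj₂ (proj₂ through) (r'-at-i , r'-at-i')) (x∈B' , y∈B')

  cover-column-long : ∀ j i f z g → ∃! _≡_ (Joined (col j i f) (lng z g))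
  cover-column-long j i f z@(z₀ , long-z₀) g =
    fill r B₀ , (∈fill (row-col j i z₀) x∈B₀ , ∈fill-long z (row-zero j i z₀) y∈B₀) , unique
    where
      r = row j i z₀
      filled = F.pair-cover r (inj₁ (j , f)) (inj₂ g) tt (subst (T ∘ long) (sym (row-zero j i z₀)) long-z₀)
                 (λ ()) (λ ())
      B₀ = proj₁ filled
      x∈B₀ = proj₁ (proj₁ (proj₂ filled))
      y∈B₀ = proj₂ (proj₁ (proj₂ filled))
      unique : ∀ {B} → Joined (col j i f) (lng z g) B → fill r B₀ ≡ B
      unique {pbd _ _} (_ , ())
      unique {fill r' B} (x∈B , y∈B) =
        let (r'-at-i , x∈B') = fill∈ r' B j i x∈B ; (r'-at-z₀ , y∈B') = fill∈-long r' B z y∈B in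
        fill-≡ B₀ B (proj₂ (proj₂ filled)) (row-unique j i z₀ r' r'-at-i r'-at-z₀) (x∈B' , y∈B')

  pair-cover : ∀ x y → group x ≢ group y → ∃! _≡_ (Joined x y)
  pair-cover (col j i f) (col j' i' f') different with j ≟ j'
  ... | yes refl = cover-same-column j i f i' f' different
  ... | no j≢j' = cover-across j i f j' i' f' j≢j' different
  pair-cover (col j i f) (lng z g) _ = cover-column-long j i f z g
  pair-cover (col j i f) ∞ _ = cover-column-∞ j i f
  pair-cover (lng z g) (col j i f) _ = swap-joined (cover-column-long j i f z g)
  pair-cover ∞ (col j i f) _ = swap-joined (cover-column-∞ j i f)
  pair-cover (inj₂ _) (inj₂ _) different = ⊥-elim (different refl)

  design : BlockDesign K group
  design = record
    { Block = Block ; #blocks = _ ; block↔ = Block↔ ; _∋_ = _∋_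
    ; block-size = block-size ; transversal = transversal ; pair-cover = pair-cover }

  gdd : GDD K (type (m * u) ℓ (t * v + 1))
  gdd = PointsDesign⇒GDD (BlockDesign-map (↔-sym Point↔) group-index group-index-injective
    (λ x → trans (cong groupOf (sym (strictlyInverseˡ Point↔ x))) (group-Point↔ (from Point↔ x))) design)

-- Placing the holes

m<n⇒m/o<⌈n/o⌉ : ∀ {x u} α .{{_ : NonZero α}} → x < u → x / α < ⌈ u / α ⌉
m<n⇒m/o<⌈n/o⌉ {x} {u} α x<u = begin
  suc (x / α)           ≡⟨ cong (λ y → suc (y / α)) (m+n∸n≡m x α) ⟨
  suc ((x + α ∸ α) / α) ≡⟨ m/n≡1+[m∸n]/n (m≤n+m α x) ⟨
  (x + α) / α           ≤⟨ /-monoˡ-≤ α x+α≤u+α-1 ⟩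
  (u + α ∸ 1) / α       ∎
  where
    open ≤-Reasoning
    1≤α = >-nonZero⁻¹ α
    x+α≤u+α-1 : x + α ≤ u + α ∸ 1
    x+α≤u+α-1 = begin
      x + α             ≡⟨ cong (x +_) (m+[n∸m]≡n 1≤α) ⟨
      x + (1 + (α ∸ 1)) ≡⟨ +-assoc x 1 (α ∸ 1) ⟨
      x + 1 + (α ∸ 1)   ≤⟨ +-monoˡ-≤ (α ∸ 1) (≤-trans (≤-reflexive (+-comm x 1)) x<u) ⟩
      u + (α ∸ 1)       ≡⟨ +-∸-assoc u 1≤α ⟨
      u + α ∸ 1         ∎

div-mod-injective : ∀ {x y} α .{{_ : NonZero α}} → x % α ≡ y % α → x / α ≡ y / α → x ≡ y
div-mod-injective {x} {y} α same-mod same-div = begin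
  x                   ≡⟨ m≡m%n+[m/n]*n x α ⟩
  x % α + x / α * α   ≡⟨ cong₂ (λ r q → r + q * α) same-mod same-div ⟩
  y % α + y / α * α   ≡⟨ m≡m%n+[m/n]*n y α ⟨
  y                   ∎
  where open ≡-Reasoning

initial-segment↔ : {t : ℕ} → t ≤ m → Sat (λ (z : Fin m) → toℕ z <ᵇ t) ↔ Fin t
initial-segment↔ {t = t} t≤m = mk↔ₛ′ (λ (z , z<t) → fromℕ< (<ᵇ⇒< (toℕ z) t z<t))
  (λ i → inject≤ i t≤m , <⇒<ᵇ (subst (_< t) (sym (toℕ-inject≤ i t≤m)) (toℕ<n i)))
  (λ i → toℕ-injective (trans (toℕ-fromℕ< _) (toℕ-inject≤ i t≤m)))
  (λ (z , _) → Sat-≡ (toℕ-injective (trans (toℕ-inject≤ _ t≤m) (toℕ-fromℕ< _))))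

-- Hole f is placed at point t + ⌊f/α⌋ of column zero, in slot f mod α; the bound makes these points exist.
module HolePlacement (α : ℕ) .{{_ : NonZero α}} {u m : ℕ} (t : ℕ) (fits : t + ⌈ u / α ⌉ ≤ m) where

  hole-point : Fin u → Fin m
  hole-point f = fromℕ< (<-≤-trans (+-monoʳ-< t (m<n⇒m/o<⌈n/o⌉ α (toℕ<n f))) fits)

  toℕ-hole-point : ∀ f → toℕ (hole-point f) ≡ t + toℕ f / α
  toℕ-hole-point f = toℕ-fromℕ< _

  slot : Fin u → Fin α
  slot f = fromℕ< (m%n<n (toℕ f) α)

  no-hole-below : ∀ z f → toℕ z < t → ¬ T (does (hole-point f ≟ z))
  no-hole-below z f z<t at-z = <⇒≱ z<t (≤-trans (m≤m+n t _)
    (≤-reflexive (trans (sym (toℕ-hole-point f)) (cong toℕ (T-does⇒ (hole-point f ≟ z) at-z)))))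

  slot-injective : ∀ z f f' → T (does (hole-point f ≟ z)) → T (does (hole-point f' ≟ z)) →
    slot f ≡ slot f' → f ≡ f'
  slot-injective z f f' at-z at-z' same-slot = toℕ-injective (div-mod-injective α
    (trans (sym (toℕ-fromℕ< _)) (trans (cong toℕ same-slot) (toℕ-fromℕ< _)))
    (+-cancelˡ-≡ t _ _ (trans (sym (toℕ-hole-point f)) (trans (cong toℕ same-point) (toℕ-hole-point f')))))
    where same-point = trans (T-does⇒ (hole-point f ≟ z) at-z) (sym (T-does⇒ (hole-point f' ≟ z) at-z'))

theorem3 : (ℓ m u v α : ℕ) → .{{_ : NonZero α}} → 1 ≤ ℓ → 1 ≤ m → 1 ≤ u → 1 ≤ v → u ≤ m →
    (K : ℕ → Set) → (∀ k → K k → 2 ≤ k) → K ℓ →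
    TD (ℓ + 1) m →
    TDWithDisjointBlocks ℓ u α →
    GDD K (replicate ℓ u ++ [ v ]) →
    PBD (m * u + 1) K →
    (t : ℕ) → t + ⌈ u / α ⌉ ≤ m →
    GDD K (replicate (m * u) ℓ ++ [ t * v + 1 ])
theorem3 ℓ m u v α 1≤ℓ _ _ _ _ K _ Kℓ TD₁ TD₂ G P t fits =
  Construction.gdd (fromℕ< 1≤ℓ) O P long (initial-segment↔ (≤-trans (m≤m+n t _) fits)) hole-point filling
  where
    open HolePlacement α {u} t fits
    O : OA (suc ℓ) m
    O = subst (λ k → OA k m) (+-comm ℓ 1) (TD⇒OA.oa TD₁)
    long : Fin m → Bool
    long z = toℕ z <ᵇ t
    filling : ∀ z → Filling K ℓ u v (long z) (λ f → does (hole-point f ≟ z))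
    filling z with long z in is-long
    ... | true = GDD⇒Filling G _ λ f → no-hole-below z f (<ᵇ⇒< (toℕ z) t (subst T (sym is-long) tt))
    ... | false = let (O₂ , rows) = TD-disjoint⇒OA TD₂ in OA⇒Filling.filling O₂ rows _ slot (slot-injective z) Kℓ
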